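{- White has a winning strategy in Multimove Chess $(3,2)$.
   Context: For positive integers $i,j$, Multimove Chess $(i,j)$ is the game played with exactly the rules of standard chess (standard starting position, standard piece moves, White plays first), except that on each of its turns White makes $i$ consecutive moves and on each of its turns Black makes $j$ consecutive moves. A side wins when it captures the opponent's king. A side "has a winning strategy" if it has a strategy guaranteed to win regardless of the opponent's play. -}

module Defs where

open import Data.Nat using (ℕ; zero; suc; _≡ᵇ_; _<ᵇ_)
open import Data.Integer using (ℤ; +_; -[1+_]) renaming (_+_ to _+ℤ_)
open import Data.Bool using (Bool; true; false; if_then_else_; _∧_; _∨_; not; T)
open import Data.Maybe using (Maybe; just; nothing; maybe′)
open import Data.List using (List; []; _∷_; _++_; map; concatMap; upTo; null; length)
open import Data.Bool.ListAction using (any)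
open import Data.List.Relation.Unary.Any using (Any)
open import Data.List.Relation.Unary.All using (All)
open import Data.Product using (_×_; _,_; proj₁; proj₂; ∃-syntax)
open import Data.Sum using (_⊎_)
open import Data.Empty using (⊥)

data Colour : Set where
  white black : Colour

opp : Colour → Colour
opp white = black
opp black = white

_==ᶜ_ : Colour → Colour → Bool
white ==ᶜ white = true
black ==ᶜ black = true
_ ==ᶜ _ = false

data Kind : Set where
  pawn knight bishop rook queen king : Kind

_==ᵏ_ : Kind → Kind → Bool
pawn ==ᵏ pawn = true
knight ==ᵏ knight = true
bishop ==ᵏ bishop = true
rook ==ᵏ rook = true
queen ==ᵏ queen = true
king ==ᵏ king = true
_ ==ᵏ _ = false

record Piece : Set where
  constructor pc
  field
    colour : Colour
    kind   : Kind

Cell : Set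
Cell = Maybe Piece

-- A square is (file , rank), both in 0..7; a1 = (0 , 0), h8 = (7 , 7).
-- White starts on ranks 0,1 and Black on ranks 6,7.
Square : Set
Square = ℕ × ℕ

file rank : Square → ℕ
file = proj₁
rank = proj₂

squares : List Square
squares = concatMap (λ f → map (λ r → (f , r)) (upTo 8)) (upTo 8)

Board : Set
Board = ℕ → ℕ → Cell

_==ˢ_ : Square → Square → Bool
(a , b) ==ˢ (c , d) = (a ≡ᵇ c) ∧ (b ≡ᵇ d)

at : Board → Square → Cell
at b (f , r) = b f r

set : Board → Square → Cell → Board
set b s x f r = if (f , r) ==ˢ s then x else b f r

isEmpty : Board → Square → Bool
isEmpty b s = maybe′ (λ _ → false) true (at b s)

isColour : Colour → Board → Square → Bool
isColour c b s = maybe′ (λ p → c ==ᶜ Piece.colour p) false (at b s)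

isPiece : Colour → Kind → Board → Square → Bool
isPiece c k b s =
  maybe′ (λ p → (c ==ᶜ Piece.colour p) ∧ (k ==ᵏ Piece.kind p)) false (at b s)

_∈ˢ_ : Square → List Square → Bool
s ∈ˢ ts = any (λ t → s ==ˢ t) ts

coord : ℕ → ℤ → Maybe ℕ
coord n d with (+ n) +ℤ d
... | + m = if m <ᵇ 8 then just m else nothing
... | -[1+ _ ] = nothing

shift : Square → ℤ × ℤ → Maybe Square
shift (f , r) (df , dr) with coord f df | coord r dr
... | just f′ | just r′ = just (f′ , r′)
... | _ | _ = nothing

m1 m2 p0 p1 p2 : ℤ
m1 = -[1+ 0 ]
m2 = -[1+ 1 ]
p0 = + 0
p1 = + 1
p2 = + 2

rookDirs bishopDirs queenDirs knightJumps : List (ℤ × ℤ)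
rookDirs = (p1 , p0) ∷ (m1 , p0) ∷ (p0 , p1) ∷ (p0 , m1) ∷ []
bishopDirs = (p1 , p1) ∷ (p1 , m1) ∷ (m1 , p1) ∷ (m1 , m1) ∷ []
queenDirs = rookDirs ++ bishopDirs
knightJumps = (p1 , p2) ∷ (p2 , p1) ∷ (p2 , m1) ∷ (p1 , m2)
            ∷ (m1 , m2) ∷ (m2 , m1) ∷ (m2 , p1) ∷ (m1 , p2) ∷ []

ray : ℕ → Colour → Board → Square → ℤ × ℤ → List Square
ray zero c b s d = []
ray (suc k) c b s d = maybe′ step [] (shift s d)
  where
  step : Square → List Square
  step t = maybe′ (λ p → if c ==ᶜ Piece.colour p then [] else t ∷ [])
                  (t ∷ ray k c b t d) (at b t)

leap : Colour → Board → Square → List (ℤ × ℤ) → List Square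
leap c b s [] = []
leap c b s (d ∷ ds) = maybe′ step (leap c b s ds) (shift s d)
  where
  step : Square → List Square
  step t = if isColour c b t then leap c b s ds else t ∷ leap c b s ds

slide : Colour → Board → Square → List (ℤ × ℤ) → List Square
slide c b s ds = concatMap (ray 7 c b s) ds

pawnDir : Colour → ℤ
pawnDir white = p1
pawnDir black = m1

pawnDir2 : Colour → ℤ
pawnDir2 white = p2
pawnDir2 black = m2

startRank lastRank homeRank : Colour → ℕ
startRank white = 1
startRank black = 6
lastRank white = 7
lastRank black = 0
homeRank white = 0
homeRank black = 7

maybeList : {A : Set} → Maybe A → List A
maybeList = maybe′ (λ a → a ∷ []) []

-- squares attacked by a (non-pawn) piece of colour c and kind k standing on s;
-- for these pieces they coincide with the target squares of ordinary moves
targets : Colour → Kind → Board → Square → List Square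
targets c pawn   b s = concatMap (λ df → maybeList (shift s (df , pawnDir c))) (p1 ∷ m1 ∷ [])
targets c knight b s = leap c b s knightJumps
targets c bishop b s = slide c b s bishopDirs
targets c rook   b s = slide c b s rookDirs
targets c queen  b s = slide c b s queenDirs
targets c king   b s = leap c b s queenDirs

attacked : Colour → Board → Square → Bool
attacked c b t = any att squares
  where
  att : Square → Bool
  att s = maybe′ (λ p → (c ==ᶜ Piece.colour p) ∧ (t ∈ˢ targets c (Piece.kind p) b s))
                 false (at b s)

record Position : Set where
  constructor mkPos
  field
    board : Board
    -- castling rights: White king-side, White queen-side, Black king-side, Black queen-side
    wK wQ bK bQ : Bool
    -- en passant: the square skipped by a pawn double step made by the
    -- immediately preceding move (nothing otherwise)
    ep : Maybe Square

open Position

-- castling rights are lost as soon as a move starts or ends on the king's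
-- or the corresponding rook's initial square
updRights : Position → Square → Square → Board → Maybe Square → Position
updRights p s t b e = mkPos b
  (wK p ∧ not (touch (4 , 0) ∨ touch (7 , 0)))
  (wQ p ∧ not (touch (4 , 0) ∨ touch (0 , 0)))
  (bK p ∧ not (touch (4 , 7) ∨ touch (7 , 7)))
  (bQ p ∧ not (touch (4 , 7) ∨ touch (0 , 7)))
  e
  where
  touch : Square → Bool
  touch q = (s ==ˢ q) ∨ (t ==ˢ q)

-- move the piece on s to t, placing x on t (x differs from the moved piece only
-- for promotions); any piece on t is captured
basicMove : Position → Square → Square → Cell → Maybe Square → Position
basicMove p s t x e = updRights p s t (set (set (board p) s nothing) t x) e

pawnArrive : Colour → Square → List Cell
pawnArrive c t =
  if rank t ≡ᵇ lastRank c
  then map (λ k → just (pc c k)) (queen ∷ rook ∷ bishop ∷ knight ∷ [])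
  else just (pc c pawn) ∷ []

epMatch : Maybe Square → Square → Bool
epMatch e t = maybe′ (λ u → u ==ˢ t) false e

pawnMoves : Colour → Position → Square → List Position
pawnMoves c p s = single ++ double ++ concatMap capture (p1 ∷ m1 ∷ [])
  where
  b = board p
  single : List Position
  single = maybe′ (λ t → if isEmpty b t
                         then map (λ x → basicMove p s t x nothing) (pawnArrive c t)
                         else [])
                  [] (shift s (p0 , pawnDir c))
  double : List Position
  double = maybe′ (λ t1 → maybe′ (λ t2 →
              if (rank s ≡ᵇ startRank c) ∧ isEmpty b t1 ∧ isEmpty b t2
              then basicMove p s t2 (just (pc c pawn)) (just t1) ∷ []
              else [])
             [] (shift s (p0 , pawnDir2 c)))
           [] (shift s (p0 , pawnDir c))
  capture : ℤ → List Position
  capture df = maybe′ cap [] (shift s (df , pawnDir c))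
    where
    cap : Square → List Position
    cap t =
      if isColour (opp c) b t
      then map (λ x → basicMove p s t x nothing) (pawnArrive c t)
      else if epMatch (ep p) t ∧ isPiece (opp c) pawn b (file t , rank s)
      then updRights p s t (set (set (set b s nothing) t (just (pc c pawn)))
                                (file t , rank s) nothing) nothing ∷ []
      else []

pieceMoves : Colour → Kind → Position → Square → List Position
pieceMoves c pawn p s = pawnMoves c p s
pieceMoves c k p s =
  map (λ t → basicMove p s t (just (pc c k)) nothing) (targets c k (board p) s)

movesFrom : Colour → Position → Square → List Position
movesFrom c p s =
  maybe′ (λ q → if c ==ᶜ Piece.colour q then pieceMoves c (Piece.kind q) p s else [])
         [] (at (board p) s)

kRight qRight : Colour → Position → Bool
kRight white p = wK p
kRight black p = bK p
qRight white p = wQ p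
qRight black p = bQ p

castleK : Colour → Position → List Position
castleK c p =
  if kRight c p ∧ isPiece c king b (4 , r) ∧ isPiece c rook b (7 , r)
     ∧ isEmpty b (5 , r) ∧ isEmpty b (6 , r)
     ∧ not (attacked (opp c) b (4 , r)) ∧ not (attacked (opp c) b (5 , r))
     ∧ not (attacked (opp c) b (6 , r))
  then updRights p (4 , r) (6 , r)
         (set (set (set (set b (4 , r) nothing) (7 , r) nothing)
                   (6 , r) (just (pc c king))) (5 , r) (just (pc c rook)))
         nothing ∷ []
  else []
  where
  b = board p
  r = homeRank c

castleQ : Colour → Position → List Position
castleQ c p =
  if qRight c p ∧ isPiece c king b (4 , r) ∧ isPiece c rook b (0 , r)
     ∧ isEmpty b (1 , r) ∧ isEmpty b (2 , r) ∧ isEmpty b (3 , r)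
     ∧ not (attacked (opp c) b (4 , r)) ∧ not (attacked (opp c) b (3 , r))
     ∧ not (attacked (opp c) b (2 , r))
  then updRights p (4 , r) (2 , r)
         (set (set (set (set b (4 , r) nothing) (0 , r) nothing)
                   (2 , r) (just (pc c king))) (3 , r) (just (pc c rook)))
         nothing ∷ []
  else []
  where
  b = board p
  r = homeRank c

-- all positions reachable by one move of colour c
-- (moves may leave the own king attacked: the game is won by capturing the king)
successors : Colour → Position → List Position
successors c p = concatMap (movesFrom c p) squares ++ castleK c p ++ castleQ c p

hasKing : Colour → Board → Bool
hasKing c b = any (isPiece c king b) squares

backRank : ℕ → Kind
backRank 0 = rook
backRank 1 = knight
backRank 2 = bishop
backRank 3 = queen
backRank 4 = king
backRank 5 = bishop
backRank 6 = knight
backRank _ = rook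

initialBoard : Board
initialBoard f r = if f <ᵇ 8 then cell r else nothing
  where
  cell : ℕ → Cell
  cell 0 = just (pc white (backRank f))
  cell 1 = just (pc white pawn)
  cell 6 = just (pc black pawn)
  cell 7 = just (pc black (backRank f))
  cell _ = nothing

initialPosition : Position
initialPosition = mkPos initialBoard true true true true nothing

-- number of consecutive moves per turn
quota : ℕ → ℕ → Colour → ℕ
quota i j white = i
quota i j black = j

-- side to move and number of moves left in its turn, after colour c made
-- a move while having k moves left (counting that move)
after : ℕ → ℕ → Colour → ℕ → Colour × ℕ
after i j c (suc (suc k)) = c , suc k
after i j c _ = opp c , quota i j (opp c)

-- If the side to move has no move at all, the game is drawn (not a White win);
-- if Black captures White's king, White has lost.
WhiteWinsWithin : ℕ → ℕ → ℕ → Colour → ℕ → Position → Set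
WhiteWinsWithin i j zero c k p = ⊥
WhiteWinsWithin i j (suc n) white k p =
  Any (λ q → T (not (hasKing black (board q)))
             ⊎ WhiteWinsWithin i j n (proj₁ (after i j white k)) (proj₂ (after i j white k)) q)
      (successors white p)
WhiteWinsWithin i j (suc n) black k p =
  T (not (null (successors black p)))
  × All (λ q → T (hasKing white (board q))
               × WhiteWinsWithin i j n (proj₁ (after i j black k)) (proj₂ (after i j black k)) q)
        (successors black p)

-- White has a winning strategy in Multimove Chess (i , j).  (The game tree is
-- finitely branching, so by König's lemma this is equivalent to White being
-- able to force a king capture within a bounded number of moves.)
WhiteHasWinningStrategy : ℕ → ℕ → Set
WhiteHasWinningStrategy i j = ∃[ n ] WhiteWinsWithin i j n white i initialPosition

-- White's first turn a3, Ra2, Nc3 puts a knight within three jumps of every square the black king can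
-- reach with Black's two moves (e8, d7, e7, f7): Nd5-f6xe8, Nd5-f6xd7, Ra2-a1 Nd5xe7 or Ne4-g5xf7.
-- Black moves no more before the knight arrives, so a knight jump cannot be parried and a black piece
-- on the route is simply captured.
module Submission where

open import Defs
open Position
open import Data.Nat using (ℕ; zero; suc; _≟_)
open import Data.Bool using (Bool; false; _∧_; _∨_; not; T)
open import Data.Bool.ListAction using (any; all)
open import Data.Bool.Properties using (T-∧; T-∨)
open import Data.List using (List; []; concatMap; null)
open import Data.List.Relation.Unary.Any as Any using (Any)
open import Data.List.Relation.Unary.Any.Properties using (++⁺ˡ; concatMap⁺; any⁻)
open import Data.List.Relation.Unary.All as All using (All)
open import Data.List.Relation.Unary.All.Properties using (all⁺)
open import Data.List.Membership.Propositional using (_∈_; lose)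
open import Data.Product as Product using (_×_; _,_; proj₁; proj₂)
open import Data.Product.Properties using (≡-dec)
open import Data.List.Membership.DecPropositional (≡-dec _≟_ _≟_) using (_∈?_)
open import Data.Sum as Sum using (_⊎_; [_,_]′)
open import Data.Unit using (tt)
open import Function using (_∘_)
open import Function.Bundles using (Equivalence)
open import Relation.Nullary using (yes; no)

playsFrom : Colour → Position → Square → List Position
playsFrom c p s with s ∈? squares
... | yes _ = movesFrom c p s
... | no  _ = []

playsFrom⁺ : ∀ {P : Position → Set} {c p} s → Any P (playsFrom c p s) → Any P (successors c p)
playsFrom⁺ {c = c} {p} s h with s ∈? squares
... | yes s∈squares = ++⁺ˡ (concatMap⁺ (movesFrom c p) (lose s∈squares h))

Move : Set
Move = Square × Square

infixr 5 _▹_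
infixr 4 _or_

-- A move (s , t) is any move of the piece on s leaving a white piece on t.  The alternatives of `or`
-- are tried in the position actually reached, so White's choice may depend on Black's replies.
data Plan : Set where
  _▹_    : Move → Plan → Plan
  reply  : Plan → Plan
  _or_   : Plan → Plan → Plan
  resign : Plan

module _ (i j : ℕ) where

  winsWithin : ℕ → Colour → ℕ → Position → Plan → Bool

  winsAfterWhiteMove : ℕ → ℕ → Square → Plan → Position → Bool
  winsAfterWhiteMove n k t π q =
    isColour white (board q) t
    ∧ (not (hasKing black (board q))
       ∨ winsWithin n (proj₁ (after i j white k)) (proj₂ (after i j white k)) q π)

  winsAfterBlackMove : ℕ → ℕ → Plan → Position → Bool
  winsAfterBlackMove n k π q =
    hasKing white (board q) ∧ winsWithin n (proj₁ (after i j black k)) (proj₂ (after i j black k)) q π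

  winsWithin zero    _     _ _ _             = false
  winsWithin (suc n) c     k p (π₁ or π₂)    = winsWithin (suc n) c k p π₁ ∨ winsWithin (suc n) c k p π₂
  winsWithin (suc n) white k p ((s , t) ▹ π) =
    any (winsAfterWhiteMove n k t π) (playsFrom white p s)
  winsWithin (suc n) black k p (reply π)     =
    not (null (successors black p)) ∧ all (winsAfterBlackMove n k π) (successors black p)
  winsWithin (suc n) _     _ _ _             = false

  winsWithin-sound : ∀ n c k p π → T (winsWithin n c k p π) → WhiteWinsWithin i j n c k p
  winsWithin-sound (suc n) c k p (π₁ or π₂) h =
    [ winsWithin-sound (suc n) c k p π₁ , winsWithin-sound (suc n) c k p π₂ ]′ (Equivalence.to T-∨ h)
  winsWithin-sound (suc n) white k p ((s , t) ▹ π) h =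
    playsFrom⁺ s (Any.map whiteMove (any⁻ _ _ h))
    where
    whiteMove : ∀ {q} → T (winsAfterWhiteMove n k t π q) →
      T (not (hasKing black (board q)))
      ⊎ WhiteWinsWithin i j n (proj₁ (after i j white k)) (proj₂ (after i j white k)) q
    whiteMove {q} hq =
      Sum.map₂ (winsWithin-sound n _ _ q π) (Equivalence.to T-∨ (proj₂ (Equivalence.to T-∧ hq)))
  winsWithin-sound (suc n) black k p (reply π) h =
    Product.map₂ (All.map blackMove ∘ all⁺ _ _) (Equivalence.to T-∧ h)
    where
    blackMove : ∀ {q} → T (winsAfterBlackMove n k π q) →
      T (hasKing white (board q))
      × WhiteWinsWithin i j n (proj₁ (after i j black k)) (proj₂ (after i j black k)) q
    blackMove {q} hq = Product.map₂ (winsWithin-sound n _ _ q π) (Equivalence.to T-∧ hq)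

a1 a2 a3 b1 c3 d5 d7 e4 e7 e8 f6 f7 g5 : Square
a1 = 0 , 0
a2 = 0 , 1
a3 = 0 , 2
b1 = 1 , 0
c3 = 2 , 2
d5 = 3 , 4
d7 = 3 , 6
e4 = 4 , 3
e7 = 4 , 6
e8 = 4 , 7
f6 = 5 , 5
f7 = 5 , 6
g5 = 6 , 4

strategy : Plan
strategy = (a2 , a3) ▹ (a1 , a2) ▹ (b1 , c3) ▹ reply (reply raid)
  where
  raid : Plan
  raid = ((c3 , d5) ▹ (d5 , f6) ▹ (f6 , e8) ▹ resign)
      or ((c3 , d5) ▹ (d5 , f6) ▹ (f6 , d7) ▹ resign)
      or ((a2 , a1) ▹ (c3 , d5) ▹ (d5 , e7) ▹ resign)
      or ((c3 , e4) ▹ (e4 , g5) ▹ (g5 , f7) ▹ resign)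

lemma4 : WhiteHasWinningStrategy 3 2
lemma4 = 8 , winsWithin-sound 3 2 8 white 3 initialPosition strategy tt
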